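{- Let $k$ be a positive integer. Then $\alpha(k,2k+1)\le \frac{7k+11}{2}$ if $k$ is odd, and $\alpha(k,2k+1)\le\frac{7k+12}{2}$ if $k$ is even.
   Context: For integers $1\le k\le n$, $\alpha(k,n)$ denotes the least number of entries equal to $1$ in an $n\times n$ matrix with entries in $\{0,1\}$ in which every $k\times k$ minor (the submatrix formed by any $k$ rows and any $k$ columns) contains at least one entry equal to $1$. -}

module Defs where

open import Data.Nat using (ℕ; zero; suc; _+_; _*_; _≤_)
open import Data.Bool using (Bool; true; false; if_then_else_)
open import Data.Fin using (Fin)
open import Data.Fin.Subset using (Subset; _∈_; ∣_∣)
open import Data.Product using (Σ; ∃; _×_; _,_)
open import Data.List using (List; map; allFin)
open import Data.Nat.ListAction using (sum)
open import Relation.Binary.PropositionalEquality using (_≡_)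

Matrix01 : ℕ → Set
Matrix01 n = Fin n → Fin n → Bool

ones : ∀ {n} → Matrix01 n → ℕ
ones {n} M = sum (map (λ i → sum (map (λ j → if M i j then 1 else 0) (allFin n))) (allFin n))

EveryMinorHasOne : ∀ {n} → ℕ → Matrix01 n → Set
EveryMinorHasOne {n} k M =
  (R C : Subset n) → ∣ R ∣ ≡ k → ∣ C ∣ ≡ k →
  Σ (Fin n) λ i → Σ (Fin n) λ j → i ∈ R × j ∈ C × M i j ≡ true

-- α(k,n) ≤ b, i.e. some admissible matrix has at most b ones
-- (α is the minimum, so this is equivalent to the paper's α(k,n) ≤ b).
α≤ : ℕ → ℕ → ℕ → Set
α≤ k n b = Σ (Matrix01 n) λ M → EveryMinorHasOne k M × ones M ≤ b

-- rational bound version: 2 · α(k,n) ≤ c, i.e. α(k,n) ≤ c/2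
2α≤ : ℕ → ℕ → ℕ → Set
2α≤ k n c = Σ (Matrix01 n) λ M → EveryMinorHasOne k M × 2 * ones M ≤ c

-- Write k = t + 2, r = k + 3 and n = 2k + 1 = r + t. The matrix is the identity plus the adjacency
-- matrix of the digraph on {0, …, r − 1} formed by the cycle i → i + 1 (mod r) and a chord
-- i → i − 2 (mod r) from every even i, so it has n + r + ⌈r/2⌉ ones: (7k + 11)/2 or (7k + 12)/2
-- according to the parity of k. Let R and C be sets of k rows and k columns. At most t rows of R
-- lie off the cycle, so S = R ∩ {0, …, r − 1} has between 2 and r − 3 elements, and such an S has
-- two distinct out-neighbours outside S: the successors of the ends of two maximal runs of S, or
-- the successor of the end of its only run together with a chord leaving the first or second
-- element of that run. So the rows of R have ones in at least k + 2 columns, and as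
-- k + (k + 2) > n, one of these columns lies in C.

module Submission where

open import Defs

open import Algebra.Properties.CommutativeSemigroup using (interchange)
open import Data.Bool using (Bool; true; false; not; _∧_; _∨_; if_then_else_; T)
open import Data.Bool.Properties using (T?; T-∧; T-∨; T-≡)
open import Data.Fin as Fin using (Fin; toℕ; fromℕ<)
open import Data.Fin.Properties using (toℕ-fromℕ<)
open import Data.Fin.Subset using (Subset; _∈_; ∣_∣)
open import Data.List using (map; allFin; tabulate)
open import Data.List.Properties using (map-cong; map-tabulate)
open import Data.Nat
open import Data.Nat.ListAction using (sum)
open import Data.Nat.Properties
open import Data.Nat.Solver using (module +-*-Solver)
open import Data.Product using (Σ; ∃-syntax; _×_; _,_)
open import Data.Sum using (_⊎_; inj₁; inj₂; [_,_])
open import Data.Vec using ([]; _∷_; here; there)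
open import Function using (_∘_)
open import Function.Bundles using (Equivalence)
open import Relation.Binary.PropositionalEquality
  using (_≡_; _≢_; refl; sym; trans; cong; cong₂; subst; subst₂)
open import Relation.Nullary using (¬_; yes; no; contradiction)
open import Relation.Nullary.Decidable using (¬?; _×-dec_; decidable-stable)
open import Relation.Unary using (Decidable)

open +-*-Solver using (solve; _:+_; _:*_; _:=_; con)

boolToℕ : Bool → ℕ
boolToℕ b = if b then 1 else 0

sumBelow : ℕ → (ℕ → ℕ) → ℕ
sumBelow zero    F = 0
sumBelow (suc m) F = F 0 + sumBelow m (F ∘ suc)

count : (ℕ → Bool) → ℕ → ℕ
count f m = sumBelow m (boolToℕ ∘ f)

sumBelow-mono : ∀ m {F G} → (∀ {i} → i < m → F i ≤ G i) → sumBelow m F ≤ sumBelow m G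
sumBelow-mono zero    _   = z≤n
sumBelow-mono (suc m) F≤G = +-mono-≤ (F≤G z<s) (sumBelow-mono m (F≤G ∘ s<s))

sumBelow-+ : ∀ m F G → sumBelow m (λ i → F i + G i) ≡ sumBelow m F + sumBelow m G
sumBelow-+ zero    F G = refl
sumBelow-+ (suc m) F G = trans (cong (F 0 + G 0 +_) (sumBelow-+ m (F ∘ suc) (G ∘ suc)))
                               (interchange +-commutativeSemigroup (F 0) (G 0) _ _)

sumBelow-const : ∀ m c → sumBelow m (λ _ → c) ≡ m * c
sumBelow-const zero    c = refl
sumBelow-const (suc m) c = cong (c +_) (sumBelow-const m c)

sumBelow-+-split : ∀ a b F → sumBelow (a + b) F ≡ sumBelow a F + sumBelow b (λ i → F (a + i))
sumBelow-+-split zero    b F = refl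
sumBelow-+-split (suc a) b F = trans (cong (F 0 +_) (sumBelow-+-split a b (F ∘ suc)))
                                     (sym (+-assoc (F 0) _ _))

boolToℕ-mono : ∀ {a b} → (T a → T b) → boolToℕ a ≤ boolToℕ b
boolToℕ-mono {false} _   = z≤n
boolToℕ-mono {true}  {true}  _   = ≤-refl
boolToℕ-mono {true}  {false} a⇒b = contradiction (a⇒b _) λ ()

count-mono : ∀ m {f g} → (∀ {i} → i < m → T (f i) → T (g i)) → count f m ≤ count g m
count-mono m f⇒g = sumBelow-mono m (boolToℕ-mono ∘ f⇒g)

count-mono-strict : ∀ m {f g a} → (∀ {i} → i < m → T (f i) → T (g i)) →
                    a < m → ¬ T (f a) → T (g a) → count f m < count g m
count-mono-strict (suc m) {f} {g} {zero} f⇒g _ fa∉ ga with f 0 | g 0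
... | false | true  = s≤s (count-mono m (f⇒g ∘ s<s))
... | true  | _     = contradiction _ fa∉
count-mono-strict (suc m) {f} {g} {suc a} f⇒g (s≤s a<m) fa∉ ga =
  +-mono-≤-< (boolToℕ-mono (f⇒g z<s)) (count-mono-strict m (f⇒g ∘ s<s) a<m fa∉ ga)

count-insert : ∀ m f {a} → a < m → ¬ T (f a) → count f m < count (λ j → f j ∨ (j ≡ᵇ a)) m
count-insert m f {a} a<m fa∉ =
  count-mono-strict m (λ _ → Equivalence.from T-∨ ∘ inj₁) a<m fa∉ (Equivalence.from T-∨ (inj₂ (≡⇒≡ᵇ a a refl)))

count≤ : ∀ m f → count f m ≤ m
count≤ zero    f = z≤n
count≤ (suc m) f = +-mono-≤ (boolToℕ-mono {f 0} {true} _) (count≤ m (f ∘ suc))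

count-false : ∀ m → count (λ _ → false) m ≡ 0
count-false m = trans (sumBelow-const m 0) (*-zeroʳ m)

count-≡ᵇ : ∀ m a → count (_≡ᵇ a) m ≤ 1
count-≡ᵇ zero    a       = z≤n
count-≡ᵇ (suc m) zero    = ≤-reflexive (cong suc (count-false m))
count-≡ᵇ (suc m) (suc a) = count-≡ᵇ m a

boolToℕ-∨ : ∀ a b → boolToℕ (a ∨ b) ≤ boolToℕ a + boolToℕ b
boolToℕ-∨ true  b = s≤s z≤n
boolToℕ-∨ false b = ≤-refl

count-∨ : ∀ m f g → count (λ i → f i ∨ g i) m ≤ count f m + count g m
count-∨ m f g = ≤-trans (sumBelow-mono m (λ {i} _ → boolToℕ-∨ (f i) (g i)))
                        (≤-reflexive (sumBelow-+ m _ _))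

count-not : ∀ m f → count f m + count (not ∘ f) m ≡ m
count-not zero    f = refl
count-not (suc m) f with f 0
... | true  = cong suc (count-not m (f ∘ suc))
... | false = trans (+-suc _ _) (cong suc (count-not m (f ∘ suc)))

witness-suc : ∀ {m} {P : ℕ → Set} → ∃[ j ] j < m × P (suc j) → ∃[ j ] j < suc m × P j
witness-suc (j , j<m , pj) = suc j , s<s j<m , pj

count-witness : ∀ m f → 0 < count f m → ∃[ a ] a < m × T (f a)
count-witness (suc m) f pos with f 0 in f0
... | true  = 0 , z<s , subst T (sym f0) _
... | false = witness-suc (count-witness m (f ∘ suc) pos)

count-overlap : ∀ m f g → m < count f m + count g m → ∃[ j ] j < m × T (f j) × T (g j)
count-overlap (suc m) f g m<c with f 0 in f0 | g 0 in g0
... | true  | true  = 0 , z<s , subst T (sym f0) _ , subst T (sym g0) _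
... | true  | false = witness-suc (count-overlap m (f ∘ suc) (g ∘ suc) (≤-pred m<c))
... | false | true  = witness-suc (count-overlap m (f ∘ suc) (g ∘ suc) (≤-pred (subst (suc m <_) (+-suc _ _) m<c)))
... | false | false = witness-suc (count-overlap m (f ∘ suc) (g ∘ suc) (<⇒≤ m<c))

module Search {P : ℕ → Set} (P? : Decidable P) where

  least : ∀ {a} m → a < m → P a → ∃[ l ] l < m × P l × (∀ {j} → j < l → ¬ P j)
  least (suc m) a<1+m Pa with anyUpTo? P? m
  ... | yes (b , b<m , Pb) with least m b<m Pb
  ...   | l , l<m , Pl , below = l , m<n⇒m<1+n l<m , Pl , below
  least (suc m) a<1+m Pa | no none =
    _ , a<1+m , Pa , λ j<a Pj → none (_ , <-≤-trans j<a (≤-pred a<1+m) , Pj)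

  greatest : ∀ {a} m → a < m → P a → ∃[ h ] a ≤ h × h < m × P h × (∀ {j} → h < j → j < m → ¬ P j)
  greatest (suc m) a<1+m Pa with P? m
  ... | yes Pm = m , ≤-pred a<1+m , ≤-refl , Pm , λ m<j j<1+m → contradiction (≤-pred j<1+m) (<⇒≱ m<j)
  ... | no ¬Pm with greatest m (≤∧≢⇒< (≤-pred a<1+m) λ { refl → ¬Pm Pa }) Pa
  ...   | h , a≤h , h<m , Ph , above = h , a≤h , m<n⇒m<1+n h<m , Ph , above′
    where
    above′ : ∀ {j} → h < j → j < suc m → ¬ P j
    above′ h<j (s≤s j≤m) with m≤n⇒m<n∨m≡n j≤m
    ... | inj₁ j<m  = above h<j j<m
    ... | inj₂ refl = ¬Pm

  boundary : ∀ {a b} → P a → a < b → ¬ P b → ∃[ e ] a ≤ e × e < b × P e × ¬ P (suc e)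
  boundary {a} {suc b} Pa (s≤s a≤b) ¬P1+b with P? b
  ... | yes Pb = b , a≤b , ≤-refl , Pb , ¬P1+b
  ... | no ¬Pb with boundary Pa (≤∧≢⇒< a≤b λ { refl → ¬Pb Pa }) ¬Pb
  ...   | e , a≤e , e<b , Pe , ¬P1+e = e , a≤e , m<n⇒m<1+n e<b , Pe , ¬P1+e

even : ℕ → Bool
even zero          = true
even (suc zero)    = false
even (suc (suc n)) = even n

even-suc : ∀ n → even (suc n) ≡ not (even n)
even-suc zero          = refl
even-suc (suc zero)    = refl
even-suc (suc (suc n)) = even-suc n

cycSucc : ℕ → ℕ → ℕ
cycSucc r i = if suc i ≡ᵇ r then 0 else suc i

chord : ℕ → ℕ → ℕ
chord r zero          = r ∸ 2
chord r (suc zero)    = r ∸ 1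
chord r (suc (suc i)) = i

arc : ℕ → ℕ → ℕ → Bool
arc r i j = (i <ᵇ r) ∧ ((j ≡ᵇ cycSucc r i) ∨ (even i ∧ (j ≡ᵇ chord r i)))

cycSucc-step : ∀ {r i} → suc i < r → cycSucc r i ≡ suc i
cycSucc-step {r} {i} 1+i<r with suc i ≡ᵇ r in eq
... | false = refl
... | true  = contradiction (≡ᵇ⇒≡ (suc i) r (subst T (sym eq) _)) (<⇒≢ 1+i<r)

cycSucc-wrap : ∀ i → cycSucc (suc i) i ≡ 0
cycSucc-wrap i with suc i ≡ᵇ suc i in eq
... | true  = refl
... | false = contradiction (≡⇒≡ᵇ (suc i) (suc i) refl) (subst T eq)

cycSucc-cases : ∀ {r i} → i < r →
                (suc i < r × cycSucc r i ≡ suc i) ⊎ (suc i ≡ r × cycSucc r i ≡ 0)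
cycSucc-cases {i = i} i<r with m≤n⇒m<n∨m≡n i<r
... | inj₁ 1+i<r = inj₁ (1+i<r , cycSucc-step 1+i<r)
... | inj₂ refl  = inj₂ (refl , cycSucc-wrap i)

cycSucc<r : ∀ {r i} → i < r → cycSucc r i < r
cycSucc<r i<r with cycSucc-cases i<r
... | inj₁ (1+i<r , eq) = subst (_< _) (sym eq) 1+i<r
... | inj₂ (1+i≡r , eq) = subst (_< _) (sym eq) (subst (0 <_) 1+i≡r z<s)

cycSucc-injective : ∀ {r i j} → i < r → j < r → cycSucc r i ≡ cycSucc r j → i ≡ j
cycSucc-injective i<r j<r eq with cycSucc-cases i<r | cycSucc-cases j<r
... | inj₁ (_ , eqi)     | inj₁ (_ , eqj)     = suc-injective (trans (sym eqi) (trans eq eqj))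
... | inj₂ (1+i≡r , _)   | inj₂ (1+j≡r , _)   = suc-injective (trans 1+i≡r (sym 1+j≡r))
... | inj₁ (_ , eqi)     | inj₂ (_ , eqj)     = contradiction (trans (sym eqi) (trans eq eqj)) λ ()
... | inj₂ (_ , eqi)     | inj₁ (_ , eqj)     = contradiction (trans (sym eqj) (trans (sym eq) eqi)) λ ()

chord<r : ∀ {r} i → i < r → chord r i < r
chord<r {suc r} zero          _   = s≤s (m∸n≤m r 1)
chord<r {suc r} (suc zero)    _   = s≤s (m∸n≤m r 0)
chord<r         (suc (suc i)) i<r = <-trans (m<n⇒m<1+n (n<1+n i)) i<r

chord-cycSucc : ∀ {r i} → i < r → ¬ T (even i) →
                T (even (cycSucc r i)) × chord r (cycSucc r i) ≡ i ∸ 1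
chord-cycSucc {r} {i} i<r odd with cycSucc-cases i<r
... | inj₁ (_ , eq) rewrite eq = even-next i odd , chord-next i odd
  where
  even-next : ∀ i → ¬ T (even i) → T (even (suc i))
  even-next i odd rewrite even-suc i with even i
  ... | false = _
  ... | true  = odd _
  chord-next : ∀ i → ¬ T (even i) → chord r (suc i) ≡ i ∸ 1
  chord-next zero odd = contradiction _ odd
  chord-next (suc i) _ = refl
... | inj₂ (1+i≡r , eq) rewrite eq | sym 1+i≡r = _ , refl

arc-cycSucc : ∀ {r i} → i < r → T (arc r i (cycSucc r i))
arc-cycSucc {r} {i} i<r =
  Equivalence.from T-∧ (<⇒<ᵇ i<r , Equivalence.from T-∨ (inj₁ (≡⇒≡ᵇ (cycSucc r i) _ refl)))

arc-chord : ∀ {r i} → i < r → T (even i) → T (arc r i (chord r i))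
arc-chord {r} {i} i<r ev =
  Equivalence.from T-∧ (<⇒<ᵇ i<r , Equivalence.from T-∨ (inj₂ (Equivalence.from T-∧ (ev , ≡⇒≡ᵇ (chord r i) _ refl))))

T-not⇒¬T : ∀ {b} → T (not b) → ¬ T b
T-not⇒¬T {false} _ ()

≤∸2 : ∀ {m r} → suc (suc m) ≤ r → m ≤ r ∸ 2
≤∸2 (s≤s (s≤s m≤r)) = m≤r

record Escape (r : ℕ) (f : ℕ → Bool) (x : ℕ) : Set where
  constructor escape
  field
    source   : ℕ
    source<r : source < r
    source∈  : T (f source)
    x<r      : x < r
    x∉       : ¬ T (f x)
    arc-x    : T (arc r source x)

record TwoEscapes (r : ℕ) (f : ℕ → Bool) : Set where
  constructor twoEscapes
  field
    {x y}   : ℕ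
    x≢y     : x ≢ y
    escapeˣ : Escape r f x
    escapeʸ : Escape r f y

module _ {r : ℕ} {f : ℕ → Bool} where

  exit-escape : ∀ {i} → i < r → T (f i) → ¬ T (f (cycSucc r i)) → Escape r f (cycSucc r i)
  exit-escape i<r i∈ next∉ = escape _ i<r i∈ (cycSucc<r i<r) next∉ (arc-cycSucc i<r)

  step-escape : ∀ {i} → suc i < r → T (f i) → ¬ T (f (suc i)) → Escape r f (suc i)
  step-escape {i} 1+i<r i∈ 1+i∉ = subst (Escape r f) (cycSucc-step 1+i<r)
    (exit-escape (<-trans (n<1+n i) 1+i<r) i∈ (subst (λ z → ¬ T (f z)) (sym (cycSucc-step 1+i<r)) 1+i∉))

  wrap-escape : ∀ {i} → suc i ≡ r → T (f i) → ¬ T (f 0) → Escape r f 0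
  wrap-escape {i} refl i∈ 0∉ = subst (Escape r f) (cycSucc-wrap i)
    (exit-escape (n<1+n i) i∈ (subst (λ z → ¬ T (f z)) (sym (cycSucc-wrap i)) 0∉))

  chord-escape : ∀ {i} → i < r → T (even i) → T (f i) → ¬ T (f (chord r i)) → Escape r f (chord r i)
  chord-escape i<r ev i∈ chord∉ = escape _ i<r i∈ (chord<r _ i<r) chord∉ (arc-chord i<r ev)

  entry-escape : ∀ {a} → suc a < r → T (f (suc a)) → ¬ T (f a) → ¬ T (f (a ∸ 1)) →
                 T (f (cycSucc r (suc a))) → ∃[ y ] a ∸ 1 ≤ y × y ≤ a × Escape r f y
  entry-escape {a} 1+a<r 1+a∈ a∉ a-1∉ next∈ with T? (even (suc a))
  entry-escape {suc a} 1+a<r 1+a∈ a∉ a-1∉ next∈ | yes ev =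
    a , ≤-refl , n≤1+n a , chord-escape 1+a<r ev 1+a∈ a-1∉
  ... | no odd with chord-cycSucc 1+a<r odd
  ...   | ev , eq = a , m∸n≤m a 1 , ≤-refl ,
                    subst (Escape r f) eq (chord-escape (cycSucc<r 1+a<r) ev next∈ (subst (λ z → ¬ T (f z)) (sym eq) a∉))

module _ {r : ℕ} {f : ℕ → Bool} (two∈ : 2 ≤ count f r) (three∉ : 3 ≤ count (not ∘ f) r) where

  private
    module Member    = Search (λ j → T? (f j))
    module NonMember = Search (λ j → ¬? (T? (f j)))

    T-stable : ∀ {j} → ¬ ¬ T (f j) → T (f j)
    T-stable = decidable-stable (T? _)

  not-only-member : ∀ a → ¬ (∀ {j} → j < r → T (f j) → j ≡ a)
  not-only-member a only-a = contradiction
    (≤-trans two∈ (≤-trans (count-mono r λ j<r j∈ → ≡⇒≡ᵇ _ a (only-a j<r j∈)) (count-≡ᵇ r a)))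
    λ { (s≤s ()) }

  nonmember-span : ∀ {a b} → (∀ {j} → j < r → j < a ⊎ b ≤ j → T (f j)) → suc (suc a) < b
  nonmember-span {a} {b} outside∈ = ≰⇒> λ b≤2+a → contradiction
    (≤-trans three∉ (≤-trans (count-mono r (within b≤2+a))
      (≤-trans (count-∨ r _ _) (+-mono-≤ (count-≡ᵇ r a) (count-≡ᵇ r (suc a))))))
    λ { (s≤s (s≤s ())) }
    where
    within : b ≤ suc (suc a) → ∀ {j} → j < r → T (not (f j)) → T ((j ≡ᵇ a) ∨ (j ≡ᵇ suc a))
    within b≤2+a {j} j<r j∉ with j <? a | j ≟ a | j ≟ suc a
    ... | yes j<a | _        | _         = contradiction (outside∈ j<r (inj₁ j<a)) (T-not⇒¬T j∉)
    ... | no _    | yes refl | _         = Equivalence.from T-∨ (inj₁ (≡⇒≡ᵇ j j refl))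
    ... | no _    | no _     | yes refl  = Equivalence.from T-∨ (inj₂ (≡⇒≡ᵇ j j refl))
    ... | no j≮a  | no j≢a   | no j≢1+a  = contradiction
      (outside∈ j<r (inj₂ (≤-trans b≤2+a (≤∧≢⇒< (≤∧≢⇒< (≮⇒≥ j≮a) (j≢a ∘ sym)) (j≢1+a ∘ sym)))))
      (T-not⇒¬T j∉)

  private
    0<r : 0 < r
    0<r = ≤-trans (s≤s z≤n) (≤-trans two∈ (count≤ r f))

  module _ {a} (1+a<r : suc a < r) (1+a∈ : T (f (suc a))) (1+a-least : ∀ {j} → j < suc a → ¬ T (f j)) where

    escape-after : ∀ {y} → y ≤ a → a ∸ 1 ≤ y → Escape r f y → TwoEscapes r f
    escape-after {y} y≤a a-1≤y y-esc with anyUpTo? (λ j → suc a <? j ×-dec ¬? (T? (f j))) r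
    ... | yes (b , b<r , 1+a<b , b∉) with Member.boundary 1+a∈ 1+a<b b∉
    ...   | e , 1+a≤e , e<b , e∈ , 1+e∉ =
      twoEscapes (λ y≡1+e → <⇒≱ (s≤s (subst (_≤ a) y≡1+e y≤a)) (m≤n⇒m≤1+n 1+a≤e)) y-esc
                 (step-escape (≤-<-trans e<b b<r) e∈ 1+e∉)
    -- Here S = {a + 1, …, r − 1}, whose end wraps around to 0 ≠ y since a ≥ 2.
    escape-after {y} y≤a a-1≤y y-esc | no no-gap =
      twoEscapes y≢0 y-esc (wrap-escape (suc-pred r) (after∈ r-1<r (<⇒≤pred 1+a<r)) (1+a-least z<s))
      where
      instance _ = >-nonZero 0<r
      r-1<r : pred r < r
      r-1<r = subst (pred r <_) (suc-pred r) (n<1+n (pred r))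
      after∈ : ∀ {j} → j < r → suc a ≤ j → T (f j)
      after∈ {j} j<r 1+a≤j with m≤n⇒m<n∨m≡n 1+a≤j
      ... | inj₂ refl  = 1+a∈
      ... | inj₁ 1+a<j = T-stable λ j∉ → no-gap (j , j<r , 1+a<j , j∉)
      y≢0 : y ≢ 0
      y≢0 refl = contradiction
        (≤-trans (∸-monoˡ-≤ 1 (≤-pred (nonmember-span {0} λ j<r → [ (λ ()) , after∈ j<r ]))) a-1≤y)
        λ ()

    twoEscapes-0∉ : TwoEscapes r f
    twoEscapes-0∉ with T? (f (cycSucc r (suc a)))
    ... | yes next∈ with entry-escape 1+a<r 1+a∈ (1+a-least ≤-refl) (1+a-least (s≤s (m∸n≤m a 1))) next∈
    ...   | y , a-1≤y , y≤a , y-esc = escape-after y≤a a-1≤y y-esc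
    twoEscapes-0∉ | no next∉ with Member.greatest r 1+a<r 1+a∈
    ... | m , _ , m<r , m∈ , m-greatest =
      twoEscapes (λ eq → m≢1+a (sym (cycSucc-injective 1+a<r m<r eq)))
                 (exit-escape 1+a<r 1+a∈ next∉) (exit-escape m<r m∈ m-next∉)
      where
      m≢1+a : m ≢ suc a
      m≢1+a refl = not-only-member (suc a) λ j<r j∈ →
        ≤-antisym (≮⇒≥ λ 1+a<j → m-greatest 1+a<j j<r j∈) (≮⇒≥ λ j<1+a → 1+a-least j<1+a j∈)
      m-next∉ : ¬ T (f (cycSucc r m))
      m-next∉ with cycSucc-cases m<r
      ... | inj₁ (1+m<r , eq) rewrite eq = m-greatest (n<1+n m) 1+m<r
      ... | inj₂ (_ , eq)     rewrite eq = 1+a-least z<s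

  module _ (0∈ : T (f 0)) where

    no-wrap : ∀ {m} → suc m < r → T (f m) → (∀ {j} → m < j → j < r → ¬ T (f j)) → TwoEscapes r f
    no-wrap {m} 1+m<r m∈ m-greatest with anyUpTo? (λ j → ¬? (T? (f j))) m
    ... | yes (b , b<m , b∉) with Member.boundary 0∈ (n≢0⇒n>0 λ { refl → b∉ 0∈ }) b∉
    ...   | e , _ , e<b , e∈ , 1+e∉ =
      twoEscapes (λ eq → <⇒≢ (<-trans e<b b<m) (suc-injective eq))
                 (step-escape (≤-<-trans e<b (<-trans b<m (<-trans (n<1+n m) 1+m<r))) e∈ 1+e∉)
                 (step-escape 1+m<r m∈ (m-greatest (n<1+n m) 1+m<r))
    -- Here S = {0, …, m}, and the chord 0 → r − 2 leaves it beyond m + 1.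
    no-wrap {m} 1+m<r m∈ m-greatest | no no-gap =
      twoEscapes (<⇒≢ 1+m<r-2) (step-escape 1+m<r m∈ (m-greatest (n<1+n m) 1+m<r))
                 (chord-escape 0<r _ 0∈ (m-greatest (<-trans (n<1+n m) 1+m<r-2) (chord<r 0 0<r)))
      where
      upto-m∈ : ∀ {j} → j < suc m → T (f j)
      upto-m∈ {j} (s≤s j≤m) with m≤n⇒m<n∨m≡n j≤m
      ... | inj₂ refl = m∈
      ... | inj₁ j<m  = T-stable λ j∉ → no-gap (j , j<m , j∉)
      1+m<r-2 : suc m < r ∸ 2
      1+m<r-2 = ≤∸2 (nonmember-span {suc m} λ j<r → [ upto-m∈ , (λ r≤j → contradiction j<r (≤⇒≯ r≤j)) ])

    module _ {g h} (1+g<r : suc g < r) (1+g∉ : ¬ T (f (suc g))) (1+g-least : ∀ {j} → j < suc g → T (f j))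
                   (1+g≤h : suc g ≤ h) (1+h<r : suc h < r) (h∉ : ¬ T (f h))
                   (h-greatest : ∀ {j} → h < j → j < r → T (f j)) where

      private
        escapeᵍ : Escape r f (suc g)
        escapeᵍ = step-escape 1+g<r (1+g-least ≤-refl) 1+g∉

        1+g<h-1 : suc g < h ∸ 1
        1+g<h-1 = ∸-monoˡ-≤ 1 (≤-pred (nonmember-span {suc g} λ j<r →
                    [ 1+g-least , (λ 1+h≤j → h-greatest 1+h≤j j<r) ]))

        next∈ : T (f (cycSucc r (suc h)))
        next∈ with cycSucc-cases 1+h<r
        ... | inj₁ (2+h<r , eq) rewrite eq = h-greatest (m<n⇒m<1+n (n<1+n h)) 2+h<r
        ... | inj₂ (_ , eq)     rewrite eq = 0∈

      member-between : ∀ {j} → j < h → suc g < j → T (f j) → TwoEscapes r f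
      member-between j<h 1+g<j j∈ with Member.boundary j∈ j<h h∉
      ... | e , j≤e , e<h , e∈ , 1+e∉ =
        twoEscapes (λ eq → <⇒≢ (<-trans (n<1+n g) (<-≤-trans 1+g<j j≤e)) (suc-injective eq))
                   escapeᵍ (step-escape (≤-<-trans e<h (<-trans (n<1+n h) 1+h<r)) e∈ 1+e∉)

      no-member-between : (∀ {j} → j < h → suc g < j → ¬ T (f j)) → TwoEscapes r f
      no-member-between between∉
        with entry-escape 1+h<r (h-greatest (n<1+n h) 1+h<r) h∉
               (between∉ (∸-monoʳ-< z<s (≤-trans (s≤s z≤n) 1+g≤h)) 1+g<h-1) next∈
      ... | y , h-1≤y , _ , y-esc = twoEscapes (λ eq → <⇒≢ (<-≤-trans 1+g<h-1 h-1≤y) eq) escapeᵍ y-esc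

      wraps-around : TwoEscapes r f
      wraps-around with anyUpTo? (λ j → suc g <? j ×-dec T? (f j)) h
      ... | yes (j , j<h , 1+g<j , j∈) = member-between j<h 1+g<j j∈
      ... | no none = no-member-between λ j<h 1+g<j j∈ → none (_ , j<h , 1+g<j , j∈)

    twoEscapes-0∈ : TwoEscapes r f
    twoEscapes-0∈ with Member.greatest r 0<r 0∈
    ... | m , _ , m<r , m∈ , m-greatest with cycSucc-cases m<r
    ...   | inj₁ (1+m<r , _) = no-wrap 1+m<r m∈ m-greatest
    ...   | inj₂ (1+m≡r , _) with count-witness r (not ∘ f) (≤-trans (s≤s z≤n) three∉)
    ...     | c , c<r , c∉ with NonMember.least r c<r (T-not⇒¬T c∉)
    ...       | zero , _ , 0∉ , _ = contradiction 0∈ 0∉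
    ...       | suc g , 1+g<r , 1+g∉ , 1+g-least with NonMember.greatest r 1+g<r 1+g∉
    ...           | h , 1+g≤h , h<r , h∉ , h-greatest =
      wraps-around 1+g<r 1+g∉ (T-stable ∘ 1+g-least) 1+g≤h 1+h<r h∉ (λ h<j j<r → T-stable (h-greatest h<j j<r))
      where
      1+h<r : suc h < r
      1+h<r = subst (suc h <_) 1+m≡r
                (s≤s (≤∧≢⇒< (≤-pred (subst (h <_) (sym 1+m≡r) h<r)) λ { refl → h∉ m∈ }))

  two-escapes : TwoEscapes r f
  two-escapes with count-witness r f (≤-trans (s≤s z≤n) two∈)
  ... | c , c<r , c∈ with Member.least r c<r c∈
  ...   | zero  , _     , 0∈   , _         = twoEscapes-0∈ 0∈
  ...   | suc a , 1+a<r , 1+a∈ , 1+a-least = twoEscapes-0∉ 1+a<r 1+a∈ 1+a-least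

entry : ℕ → ℕ → ℕ → Bool
entry r i j = (j ≡ᵇ i) ∨ arc r i j

lift : ∀ {n} → (ℕ → ℕ → Bool) → Matrix01 n
lift B i j = B (toℕ i) (toℕ j)

member : ∀ {n} → Subset n → ℕ → Bool
member []      _       = false
member (b ∷ p) zero    = b
member (b ∷ p) (suc i) = member p i

∣p∣≡count-member : ∀ {n} (p : Subset n) → ∣ p ∣ ≡ count (member p) n
∣p∣≡count-member []          = refl
∣p∣≡count-member (true ∷ p)  = cong suc (∣p∣≡count-member p)
∣p∣≡count-member (false ∷ p) = ∣p∣≡count-member p

member⇒∈ : ∀ {n} (p : Subset n) (i : Fin n) → T (member p (toℕ i)) → i ∈ p
member⇒∈ (true ∷ p) Fin.zero    _ = here
member⇒∈ (_ ∷ p)    (Fin.suc i) m = there (member⇒∈ p i m)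

sum-allFin : ∀ m (g : ℕ → ℕ) → sum (map (g ∘ toℕ) (allFin m)) ≡ sumBelow m g
sum-allFin m g = trans (cong sum (map-tabulate {n = m} (λ i → i) (g ∘ toℕ))) (sum-tabulate m g)
  where
  sum-tabulate : ∀ m (g : ℕ → ℕ) → sum (tabulate {n = m} (g ∘ toℕ)) ≡ sumBelow m g
  sum-tabulate zero    g = refl
  sum-tabulate (suc m) g = cong (g 0 +_) (sum-tabulate m (g ∘ suc))

ones-lift : ∀ n B → ones (lift {n} B) ≡ sumBelow n (λ i → count (B i) n)
ones-lift n B = trans (cong sum (map-cong (λ i → sum-allFin n (boolToℕ ∘ B (toℕ i))) (allFin n)))
                      (sum-allFin n (λ i → count (B i) n))

count-∧ : ∀ m c g → count (λ j → c ∧ g j) m ≤ boolToℕ c * count g m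
count-∧ m true  g = ≤-reflexive (sym (*-identityˡ _))
count-∧ m false g = ≤-reflexive (count-false m)

count-entry : ∀ r i m → count (entry r i) m ≤ 1 + boolToℕ (i <ᵇ r) * (1 + boolToℕ (even i))
count-entry r i m =
  ≤-trans (count-∨ m _ _) (+-mono-≤ (count-≡ᵇ m i)
    (≤-trans (count-∧ m (i <ᵇ r) _) (*-monoʳ-≤ (boolToℕ (i <ᵇ r))
      (≤-trans (count-∨ m _ _) (+-mono-≤ (count-≡ᵇ m _)
        (≤-trans (count-∧ m (even i) _) (≤-reflexive-* (count-≡ᵇ m _))))))))
  where
  ≤-reflexive-* : ∀ {c x} → x ≤ 1 → boolToℕ c * x ≤ boolToℕ c
  ≤-reflexive-* {c} x≤1 = ≤-trans (*-monoʳ-≤ (boolToℕ c) x≤1) (≤-reflexive (*-identityʳ _))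

sumBelow-gate : ∀ r n F → r ≤ n → sumBelow n (λ i → boolToℕ (i <ᵇ r) * F i) ≡ sumBelow r F
sumBelow-gate zero    zero    F _         = refl
sumBelow-gate zero    (suc n) F _         = trans (sumBelow-const n 0) (*-zeroʳ n)
sumBelow-gate (suc r) (suc n) F (s≤s r≤n) = cong₂ _+_ (*-identityˡ (F 0)) (sumBelow-gate r n (F ∘ suc) r≤n)

ones-entry≤ : ∀ {r n} → r ≤ n → ones (lift {n} (entry r)) ≤ n + (r + count even r)
ones-entry≤ {r} {n} r≤n = begin
  ones (lift {n} (entry r))
    ≡⟨ ones-lift n (entry r) ⟩
  sumBelow n (λ i → count (entry r i) n)
    ≤⟨ sumBelow-mono n (λ {i} _ → count-entry r i n) ⟩
  sumBelow n (λ i → 1 + boolToℕ (i <ᵇ r) * (1 + boolToℕ (even i)))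
    ≡⟨ sumBelow-+ n _ _ ⟩
  sumBelow n (λ _ → 1) + sumBelow n (λ i → boolToℕ (i <ᵇ r) * (1 + boolToℕ (even i)))
    ≡⟨ cong₂ _+_ (sumBelow-ones n) (sumBelow-gate r n _ r≤n) ⟩
  n + sumBelow r (λ i → 1 + boolToℕ (even i))
    ≡⟨ cong (n +_) (trans (sumBelow-+ r _ _) (cong (_+ count even r) (sumBelow-ones r))) ⟩
  n + (r + count even r) ∎
  where
  open ≤-Reasoning
  sumBelow-ones : ∀ m → sumBelow m (λ _ → 1) ≡ m
  sumBelow-ones m = trans (sumBelow-const m 1) (*-identityʳ m)

double-count-even : ∀ m → 2 * count even m ≡ m + m % 2
double-count-even zero          = refl
double-count-even (suc zero)    = refl
double-count-even (suc (suc m)) = trans (*-suc 2 (count even m)) (cong (2 +_) (double-count-even m))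

suc-%2 : ∀ k → suc k % 2 ≡ 1 ∸ k % 2
suc-%2 zero          = refl
suc-%2 (suc zero)    = refl
suc-%2 (suc (suc k)) = suc-%2 k

lift-witness : ∀ {n} B (R C : Subset n) {a b} → a < n → b < n →
               T (member R a) → T (member C b) → T (B a b) →
               Σ (Fin n) λ i → Σ (Fin n) λ j → i ∈ R × j ∈ C × lift B i j ≡ true
lift-witness B R C a<n b<n a∈ b∈ ab =
  fromℕ< a<n , fromℕ< b<n ,
  member⇒∈ R _ (subst (T ∘ member R) (sym (toℕ-fromℕ< a<n)) a∈) ,
  member⇒∈ C _ (subst (T ∘ member C) (sym (toℕ-fromℕ< b<n)) b∈) ,
  Equivalence.to T-≡ (subst₂ (λ u v → T (B u v)) (sym (toℕ-fromℕ< a<n)) (sym (toℕ-fromℕ< b<n)) ab)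

module Construction (t : ℕ) where

  k r n : ℕ
  k = 2 + t
  r = 3 + k
  n = 2 * k + 1

  matrix : Matrix01 n
  matrix = lift (entry r)

  private
    n≡r+t : n ≡ r + t
    n≡r+t = solve 1 (λ t → con 2 :* (con 2 :+ t) :+ con 1 := (con 3 :+ (con 2 :+ t)) :+ t) refl t

    r≤n : r ≤ n
    r≤n = subst (r ≤_) (sym n≡r+t) (m≤m+n r t)

  module _ (R : Subset n) (|R|≡k : ∣ R ∣ ≡ k) where

    private
      count-R : count (member R) n ≡ k
      count-R = trans (sym (∣p∣≡count-member R)) |R|≡k

      split : count (member R) n ≡ count (member R) r + count (λ i → member R (r + i)) t
      split = trans (cong (count (member R)) n≡r+t) (sumBelow-+-split r t (boolToℕ ∘ member R))

      cycle-rows≤k : count (member R) r ≤ k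
      cycle-rows≤k = ≤-trans (m≤m+n _ _) (≤-reflexive (trans (sym split) count-R))

    two-rows-in-cycle : 2 ≤ count (member R) r
    two-rows-in-cycle = +-cancelʳ-≤ t 2 _ (begin
      2 + t                                                    ≡⟨ trans (sym count-R) split ⟩
      count (member R) r + count (λ i → member R (r + i)) t    ≤⟨ +-monoʳ-≤ _ (count≤ t _) ⟩
      count (member R) r + t                                   ∎)
      where open ≤-Reasoning

    three-nonrows-in-cycle : 3 ≤ count (not ∘ member R) r
    three-nonrows-in-cycle = +-cancelʳ-≤ k 3 _ (begin
      3 + k                                           ≡⟨ sym (count-not r (member R)) ⟩
      count (member R) r + count (not ∘ member R) r   ≤⟨ +-monoˡ-≤ _ cycle-rows≤k ⟩
      k + count (not ∘ member R) r                    ≡⟨ +-comm k _ ⟩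
      count (not ∘ member R) r + k                    ∎)
      where open ≤-Reasoning

    module _ (C : Subset n) (|C|≡k : ∣ C ∣ ≡ k) {x y} (x≢y : x ≢ y)
             (escˣ : Escape r (member R) x) (escʸ : Escape r (member R) y) where

      private
        open Escape

        coveredˣ covered : ℕ → Bool
        coveredˣ j = member R j ∨ (j ≡ᵇ x)
        covered  j = coveredˣ j ∨ (j ≡ᵇ y)

        k+2≤covered : suc (suc k) ≤ count covered n
        k+2≤covered = begin
          suc (suc k)                     ≡⟨ cong (suc ∘ suc) (sym count-R) ⟩
          suc (suc (count (member R) n))  ≤⟨ s≤s (count-insert n (member R) (<-≤-trans (x<r escˣ) r≤n) (x∉ escˣ)) ⟩
          suc (count coveredˣ n)          ≤⟨ count-insert n coveredˣ (<-≤-trans (x<r escʸ) r≤n) y∉ ⟩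
          count covered n                 ∎
          where
          open ≤-Reasoning
          y∉ : ¬ T (coveredˣ y)
          y∉ = [ x∉ escʸ , x≢y ∘ sym ∘ ≡ᵇ⇒≡ y x ] ∘ Equivalence.to T-∨

        n<C+covered : n < count (member C) n + count covered n
        n<C+covered =
          ≤-trans (≤-reflexive (solve 1 (λ k → con 1 :+ (con 2 :* k :+ con 1) := k :+ (con 2 :+ k)) refl k))
                  (+-mono-≤ (≤-reflexive (trans (sym |C|≡k) (∣p∣≡count-member C))) k+2≤covered)

        diagonal : ∀ j → T (entry r j j)
        diagonal j = Equivalence.from T-∨ (inj₁ (≡⇒≡ᵇ j j refl))

        from-escape : ∀ {z j} → Escape r (member R) z → T (j ≡ᵇ z) → j < n → T (member C j) →
                      Σ (Fin n) λ i → Σ (Fin n) λ j → i ∈ R × j ∈ C × matrix i j ≡ true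
        from-escape {z} {j} esc j≡z j<n j∈C with ≡ᵇ⇒≡ j z j≡z
        ... | refl = lift-witness (entry r) R C (<-≤-trans (source<r esc) r≤n) j<n
                                  (source∈ esc) j∈C (Equivalence.from T-∨ (inj₂ (arc-x esc)))

      minor-has-one : Σ (Fin n) λ i → Σ (Fin n) λ j → i ∈ R × j ∈ C × matrix i j ≡ true
      minor-has-one with count-overlap n (member C) covered n<C+covered
      ... | j , j<n , j∈C , j-covered with Equivalence.to T-∨ j-covered
      ...   | inj₂ j≡y = from-escape escʸ j≡y j<n j∈C
      ...   | inj₁ j-covered′ with Equivalence.to T-∨ j-covered′
      ...     | inj₁ j∈R = lift-witness (entry r) R C j<n j<n j∈R j∈C (diagonal j)
      ...     | inj₂ j≡x = from-escape escˣ j≡x j<n j∈C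

  matrix-minors : EveryMinorHasOne k matrix
  matrix-minors R C |R|≡k |C|≡k with two-escapes (two-rows-in-cycle R |R|≡k) (three-nonrows-in-cycle R |R|≡k)
  ... | twoEscapes x≢y escˣ escʸ = minor-has-one R |R|≡k C |C|≡k x≢y escˣ escʸ

  two-ones≤ : 2 * ones matrix ≤ 7 * k + 11 + (1 ∸ k % 2)
  two-ones≤ = begin
    2 * ones matrix                          ≤⟨ *-monoʳ-≤ 2 (ones-entry≤ r≤n) ⟩
    2 * (n + (r + count even r))             ≡⟨ distribute n r (count even r) ⟩
    2 * n + 2 * r + 2 * count even r         ≡⟨ cong (2 * n + 2 * r +_) (double-count-even r) ⟩
    2 * n + 2 * r + (r + r % 2)              ≡⟨ collect t (suc k % 2) ⟩
    7 * k + 11 + suc k % 2                   ≡⟨ cong (7 * k + 11 +_) (suc-%2 k) ⟩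
    7 * k + 11 + (1 ∸ k % 2)                 ∎
    where
    open ≤-Reasoning
    distribute : ∀ n r c → 2 * (n + (r + c)) ≡ 2 * n + 2 * r + 2 * c
    distribute = solve 3 (λ n r c → con 2 :* (n :+ (r :+ c)) := con 2 :* n :+ con 2 :* r :+ con 2 :* c) refl
    collect : ∀ t p → 2 * (2 * (2 + t) + 1) + 2 * (3 + (2 + t)) + ((3 + (2 + t)) + p) ≡ 7 * (2 + t) + 11 + p
    collect = solve 2 (λ t p → con 2 :* (con 2 :* (con 2 :+ t) :+ con 1) :+ con 2 :* (con 3 :+ (con 2 :+ t))
                                 :+ ((con 3 :+ (con 2 :+ t)) :+ p) := con 7 :* (con 2 :+ t) :+ con 11 :+ p) refl

lemma9 : (k : ℕ) → 1 ≤ k →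
    (k % 2 ≡ 1 → 2α≤ k (2 * k + 1) (7 * k + 11)) ×
    (k % 2 ≡ 0 → 2α≤ k (2 * k + 1) (7 * k + 12))
lemma9 zero ()
lemma9 1 _ = (λ _ → all-ones , all-ones-minors , ≤-refl) , λ ()
  where
  all-ones : Matrix01 3
  all-ones = lift (λ _ _ → true)
  occupied : (p : Subset 3) → ∣ p ∣ ≡ 1 → ∃[ a ] a < 3 × T (member p a)
  occupied p |p|≡1 = count-witness 3 (member p) (≤-reflexive (trans (sym |p|≡1) (∣p∣≡count-member p)))
  all-ones-minors : EveryMinorHasOne 1 all-ones
  all-ones-minors R C |R|≡1 |C|≡1 with occupied R |R|≡1 | occupied C |C|≡1
  ... | a , a<3 , a∈R | b , b<3 , b∈C = lift-witness _ R C a<3 b<3 a∈R b∈C _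
lemma9 (suc (suc t)) _ =
  (λ odd  → matrix , matrix-minors , ≤-trans (bound odd)  (≤-reflexive (+-identityʳ (7 * k + 11)))) ,
  (λ even → matrix , matrix-minors , ≤-trans (bound even) (≤-reflexive (+-assoc (7 * k) 11 1)))
  where
  open Construction t
  bound : ∀ {e} → k % 2 ≡ e → 2 * ones matrix ≤ 7 * k + 11 + (1 ∸ e)
  bound refl = two-ones≤
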